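{- For each integer $g\ge 0$ let $S_g$ be the set of numerical semigroups of genus $g$, let $n_g=\#S_g$, and let $S_g^{\bar\infty}=\{S\in S_g:\gcd(L(S))=1\}$, where $L(S)$ is the set of left elements of $S$. Then $$\lim_{g\to\infty}\frac{\#S_g^{\bar\infty}}{n_g}=1.$$
   Context: A numerical semigroup is a submonoid $S$ of the nonnegative integers $\mathbb{N}_0$ (under addition) whose complement $\mathbb{N}_0\setminus S$ is finite. The elements of $\mathbb{N}_0\setminus S$ are the gaps of $S$, and their number is the genus of $S$. The Frobenius number $F(S)$ is the largest gap of $S$. The left elements of $S$ are the elements of $S$ that are smaller than $F(S)$; $L(S)$ denotes the set of left elements. Since $0\in L(S)$ whenever $S$ has a gap, $\gcd(L(S))$ is the gcd of the nonzero left elements. -}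

module Defs where

open import Data.Nat using (ℕ; zero; suc; _+_; _<_; _≤_)
open import Data.Nat.GCD using (gcd)
open import Data.Nat.Properties using (_≟_)
open import Data.List using (List; []; _∷_; length; last; filter; upTo; foldr)
open import Data.List.Relation.Unary.Linked using (Linked)
open import Data.List.Relation.Unary.Unique.Propositional using (Unique)
open import Data.List.Membership.Propositional using (_∈_; _∉_)
open import Data.List.Membership.DecPropositional _≟_ using (_∈?_)
open import Data.Maybe using (Maybe; just; nothing)
open import Data.Product using (_×_)
open import Function.Bundles using (_⇔_)
open import Relation.Nullary using (¬?)

-- A numerical semigroup S is represented by its (finite) set of gaps,
-- given canonically as a strictly increasing list gs; S = ℕ ∖ gs.
-- S must contain 0 and be closed under addition.
IsNumericalSemigroup : List ℕ → Set
IsNumericalSemigroup gs =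
  Linked _<_ gs × (0 ∉ gs) × (∀ a b → a ∉ gs → b ∉ gs → (a + b) ∉ gs)

genus : List ℕ → ℕ
genus = length

NSGenus : ℕ → List ℕ → Set
NSGenus g gs = IsNumericalSemigroup gs × genus gs ≡ g
  where open import Relation.Binary.PropositionalEquality using (_≡_)

-- Frobenius number: the largest gap (the last one, the list being increasing);
-- undefined (nothing) for S = ℕ.
frobenius : List ℕ → Maybe ℕ
frobenius = last

leftElementsBelow : List ℕ → ℕ → List ℕ
leftElementsBelow gs F = filter (λ s → ¬? (s ∈? gs)) (upTo F)

leftElements : List ℕ → List ℕ
leftElements gs with frobenius gs
... | nothing = []
... | just F  = leftElementsBelow gs F

-- gcd of a finite list (gcd of the empty set is 0)
gcdList : List ℕ → ℕ
gcdList = foldr gcd 0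

gcdLeft : List ℕ → ℕ
gcdLeft gs = gcdList (leftElements gs)

Enumerates : (List ℕ → Set) → List (List ℕ) → Set
Enumerates P xs = Unique xs × (∀ gs → (gs ∈ xs) ⇔ P gs)

-- A semigroup of genus g whose left elements have gcd D ≠ 1 is determined by D, its Frobenius
-- number F ≤ 2g and the set Y of those y for which D·y is a gap below F.  Such a gap D·y forces,
-- besides F, at least y/2 gap multiples D·a with a ≤ y (one of D·a, D·(y − a) is always a gap)
-- and the y gaps D·a + 1 with a < y, which are not multiples of D, hence not left elements.
-- So 3y + 2 ≤ 2g, and there are at most (2g + 1)² · 2^⌊2g/3⌋ such semigroups.
-- Conversely, every composition of g − 3 into parts 1 and 2 yields a semigroup of genus g with
-- consecutive left elements m, m + 1: the gaps are 1, …, m − 1, the Frobenius number 2m − 1 and,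
-- between m + 2 and 2m − 2, the positions marked by the parts 2.  That gives fib (g − 2) ≈ φ^g
-- semigroups with gcd 1, and φ³ > 4 = (2^{2/3})³.

module Submission where

open import Defs
open import Data.Bool using (Bool; true; false; T)
open import Data.Empty using (⊥; ⊥-elim)
open import Data.List
  using (List; []; _∷_; length; _++_; map; filter; applyUpTo; upTo; last; cartesianProduct)
open import Data.List.Membership.Propositional using (_∈_; _∉_)
open import Data.List.Membership.Propositional.Properties
open import Data.List.Properties
  using (length-++; length-map; length-applyUpTo; length-upTo; length-filter; ∷-injectiveʳ; ++-cancelˡ)
open import Data.List.Relation.Binary.Sublist.Heterogeneous.Properties using (filter-Sublist)
open import Data.List.Relation.Binary.Sublist.Propositional
  using ([]; _∷_; _∷ʳ_; minimum; ⊆-refl; ⊆-antisym) renaming (_⊆_ to _⊑_; lookup to ⊑-lookup)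
open import Data.List.Relation.Binary.Subset.Propositional using (_⊆_)
open import Data.List.Relation.Unary.All using (All; all?)
import Data.List.Relation.Unary.All as All
open import Data.List.Relation.Unary.Any using (here; there)
open import Data.List.Relation.Unary.Linked using (Linked; []; [-]; _∷_; linked?)
import Data.List.Relation.Unary.Linked as Linked
open import Data.List.Relation.Unary.Linked.Properties using (Linked⇒All; applyUpTo⁺₂)
import Data.List.Relation.Unary.Linked.Properties as Linkedₚ
open import Data.List.Relation.Unary.Unique.Propositional using (Unique; []; _∷_)
import Data.List.Relation.Unary.Unique.Propositional.Properties as Unique
open import Data.Maybe using (just)
open import Data.Nat
  using (ℕ; zero; suc; _+_; _*_; _∸_; _^_; _/_; _≤_; _<_; z≤n; s≤s; z<s; s<s; _<?_; _≤?_; _<ᵇ_;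
         NonZero; ≢-nonZero; >-nonZero)
open import Data.Nat.DivMod using (m*n/n≡m; /-monoˡ-≤; +-distrib-/-∣ʳ)
open import Data.Nat.Divisibility
  using (_∣_; _∣?_; divides; ∣-trans; ∣⇒≤; ∣1⇒≡1; ∣m+n∣m⇒∣n; m∣m*n)
open import Data.Nat.GCD using (gcd[m,n]∣m; gcd[m,n]∣n; gcd-identityˡ)
open import Data.Nat.Properties
open import Data.List.Membership.DecPropositional _≟_ using (_∈?_)
open import Data.Nat.Tactic.RingSolver using (solve-∀)
open import Data.Product using (_×_; _,_; proj₁; proj₂; uncurry; ∃-syntax)
open import Data.Sum using (_⊎_; inj₁; inj₂)
open import Data.Unit using (tt)
open import Function using (_∘_; id)
open import Function.Bundles using (mk⇔; Equivalence)
open import Relation.Binary.PropositionalEquality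
open import Relation.Nullary using (¬_; Dec; yes; no; ¬?; _×-dec_; _⊎-dec_)
open import Relation.Nullary.Decidable using (map′)
open import Relation.Unary using (Decidable)
open import Relation.Unary.Properties using (∁?)

private variable
  A B : Set

length-filter-∁ : {P : A → Set} (P? : Decidable P) (xs : List A) →
  length (filter P? xs) + length (filter (∁? P?) xs) ≡ length xs
length-filter-∁ P? [] = refl
length-filter-∁ P? (x ∷ xs) with P? x
... | yes _ = cong suc (length-filter-∁ P? xs)
... | no _  = trans (+-suc _ _) (cong suc (length-filter-∁ P? xs))

∈-∷⁻ : {x y : A} {xs : List A} → x ∈ y ∷ xs → x ≢ y → x ∈ xs
∈-∷⁻ (here x≡y) x≢y = ⊥-elim (x≢y x≡y)
∈-∷⁻ (there x∈xs) _ = x∈xs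

∈-++-∷⁻ : {x y : A} (us : List A) {vs : List A} → x ∈ us ++ y ∷ vs → x ≢ y → x ∈ us ++ vs
∈-++-∷⁻ []       x∈ x≢y = ∈-∷⁻ x∈ x≢y
∈-++-∷⁻ (u ∷ us) (here x≡u) _ = here x≡u
∈-++-∷⁻ (u ∷ us) (there x∈) x≢y = there (∈-++-∷⁻ us x∈ x≢y)

Unique-⊆⇒length-≤ : {xs ys : List A} → Unique xs → xs ⊆ ys → length xs ≤ length ys
Unique-⊆⇒length-≤ {xs = []} _ _ = z≤n
Unique-⊆⇒length-≤ {xs = x ∷ xs} (x∉xs ∷ uxs) xs⊆ys with ∈-∃++ (xs⊆ys (here refl))
... | us , vs , refl = begin
  suc (length xs)             ≤⟨ s≤s (Unique-⊆⇒length-≤ uxs xs⊆us++vs) ⟩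
  suc (length (us ++ vs))     ≡⟨ cong suc (length-++ us) ⟩
  suc (length us + length vs) ≡⟨ +-suc (length us) (length vs) ⟨
  length us + length (x ∷ vs) ≡⟨ length-++ us ⟨
  length (us ++ x ∷ vs)       ∎
  where
  open ≤-Reasoning
  xs⊆us++vs : xs ⊆ us ++ vs
  xs⊆us++vs z∈xs = ∈-++-∷⁻ us (xs⊆ys (there z∈xs)) (λ { refl → All.lookup x∉xs z∈xs refl })

Unique-map⁺-on : {f : A → B} {xs : List A} →
  (∀ {a b} → a ∈ xs → b ∈ xs → f a ≡ f b → a ≡ b) → Unique xs → Unique (map f xs)
Unique-map⁺-on {xs = []} _ [] = []
Unique-map⁺-on {f = f} {xs = x ∷ xs} inj (x∉xs ∷ uxs) =
  All.tabulate fx∉ ∷ Unique-map⁺-on (λ a∈ b∈ → inj (there a∈) (there b∈)) uxs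
  where
  fx∉ : ∀ {z} → z ∈ map f xs → f x ≢ z
  fx∉ z∈ fx≡z with ∈-map⁻ f z∈
  ... | a , a∈xs , refl = All.lookup x∉xs a∈xs (inj (here refl) (there a∈xs) fx≡z)

length-cartesianProduct : (xs : List A) (ys : List B) →
  length (cartesianProduct xs ys) ≡ length xs * length ys
length-cartesianProduct [] ys = refl
length-cartesianProduct (x ∷ xs) ys = begin
  length (map (x ,_) ys ++ cartesianProduct xs ys)
    ≡⟨ length-++ (map (x ,_) ys) ⟩
  length (map (x ,_) ys) + length (cartesianProduct xs ys)
    ≡⟨ cong₂ _+_ (length-map (x ,_) ys) (length-cartesianProduct xs ys) ⟩
  length ys + length xs * length ys ∎
  where open ≡-Reasoning

sublists : List A → List (List A)
sublists []       = [] ∷ []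
sublists (x ∷ xs) = map (x ∷_) (sublists xs) ++ sublists xs

length-sublists : (xs : List A) → length (sublists xs) ≡ 2 ^ length xs
length-sublists [] = refl
length-sublists (x ∷ xs) = begin
  length (map (x ∷_) (sublists xs) ++ sublists xs)
    ≡⟨ length-++ (map (x ∷_) (sublists xs)) ⟩
  length (map (x ∷_) (sublists xs)) + length (sublists xs)
    ≡⟨ cong (_+ length (sublists xs)) (length-map (x ∷_) (sublists xs)) ⟩
  length (sublists xs) + length (sublists xs)
    ≡⟨ cong (λ n → n + n) (length-sublists xs) ⟩
  2 ^ length xs + 2 ^ length xs
    ≡⟨ cong (2 ^ length xs +_) (+-identityʳ (2 ^ length xs)) ⟨
  2 ^ length (x ∷ xs) ∎
  where open ≡-Reasoning

∈-sublists⁺ : {xs ys : List A} → ys ⊑ xs → ys ∈ sublists xs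
∈-sublists⁺ []             = here refl
∈-sublists⁺ (x ∷ʳ ys⊑xs)   = ∈-++⁺ʳ (map (x ∷_) _) (∈-sublists⁺ ys⊑xs)
∈-sublists⁺ (refl ∷ ys⊑xs) = ∈-++⁺ˡ (∈-map⁺ (_ ∷_) (∈-sublists⁺ ys⊑xs))

∈-sublists⁻ : {xs ys : List A} → ys ∈ sublists xs → ys ⊑ xs
∈-sublists⁻ {xs = []} (here refl) = []
∈-sublists⁻ {xs = x ∷ xs} ys∈ with ∈-++⁻ (map (x ∷_) (sublists xs)) ys∈
... | inj₂ ys∈′ = x ∷ʳ ∈-sublists⁻ ys∈′
... | inj₁ ys∈′ with ∈-map⁻ (x ∷_) ys∈′
...   | zs , zs∈ , refl = refl ∷ ∈-sublists⁻ zs∈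

sublists-unique : {xs : List A} → Unique xs → Unique (sublists xs)
sublists-unique {xs = []} [] = All.[] ∷ []
sublists-unique {xs = x ∷ xs} (x∉xs ∷ uxs) =
  Unique.++⁺ (Unique.map⁺ ∷-injectiveʳ (sublists-unique uxs)) (sublists-unique uxs) disjoint
  where
  disjoint : ∀ {v} → v ∈ map (x ∷_) (sublists xs) × v ∈ sublists xs → ⊥
  disjoint (v∈₁ , v∈₂) with ∈-map⁻ (x ∷_) v∈₁
  ... | _ , _ , refl = All.lookup x∉xs (⊑-lookup (∈-sublists⁻ v∈₂) (here refl)) refl

last-∈ : {F : A} (xs : List A) → last xs ≡ just F → F ∈ xs
last-∈ (x ∷ []) refl = here refl
last-∈ (x ∷ y ∷ xs) eq = there (last-∈ (y ∷ xs) eq)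

last-∷ : {F : A} (x : A) (xs : List A) → last xs ≡ just F → last (x ∷ xs) ≡ just F
last-∷ x (y ∷ xs) eq = eq

last-++ : {F : A} (xs : List A) {ys : List A} → last ys ≡ just F → last (xs ++ ys) ≡ just F
last-++ [] eq = eq
last-++ (x ∷ xs) eq = last-∷ x (xs ++ _) (last-++ xs eq)

last-∷-just : (x : A) (xs : List A) → ∃[ F ] last (x ∷ xs) ≡ just F
last-∷-just x [] = x , refl
last-∷-just x (y ∷ xs) = last-∷-just y xs

sorted-head-< : ∀ {x z xs} → Linked _<_ (x ∷ xs) → z ∈ xs → x < z
sorted-head-< (x<y ∷ sorted) z∈ = All.lookup (Linked⇒All <-trans x<y sorted) z∈

sorted-head-≤ : ∀ {x z xs} → Linked _<_ (x ∷ xs) → z ∈ x ∷ xs → x ≤ z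
sorted-head-≤ _ (here refl) = ≤-refl
sorted-head-≤ sorted (there z∈) = <⇒≤ (sorted-head-< sorted z∈)

sorted⇒unique : ∀ {xs} → Linked _<_ xs → Unique xs
sorted⇒unique {[]} _ = []
sorted⇒unique {x ∷ xs} sorted =
  All.tabulate (λ z∈ x≡z → <-irrefl x≡z (sorted-head-< sorted z∈)) ∷ sorted⇒unique (Linked.tail sorted)

sorted-++⁺ : ∀ {xs ys} → Linked _<_ xs → Linked _<_ ys →
  (∀ {a b} → a ∈ xs → b ∈ ys → a < b) → Linked _<_ (xs ++ ys)
sorted-++⁺ {[]} _ sys _ = sys
sorted-++⁺ {x ∷ []} {[]} _ _ _ = [-]
sorted-++⁺ {x ∷ []} {y ∷ ys} _ sys x<ys = x<ys (here refl) (here refl) ∷ sys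
sorted-++⁺ {x ∷ x′ ∷ xs} (x<x′ ∷ sxs) sys xs<ys = x<x′ ∷ sorted-++⁺ sxs sys (xs<ys ∘ there)

sorted-≤-last : ∀ {F z xs} → Linked _<_ xs → last xs ≡ just F → z ∈ xs → z ≤ F
sorted-≤-last {xs = x ∷ []} _ refl (here refl) = ≤-refl
sorted-≤-last {xs = x ∷ y ∷ xs} sorted eq (here refl) = <⇒≤ (sorted-head-< sorted (last-∈ (y ∷ xs) eq))
sorted-≤-last {xs = x ∷ y ∷ xs} sorted eq (there z∈) = sorted-≤-last (Linked.tail sorted) eq z∈

sorted-⊆⇒⊑ : ∀ {xs ys} → Linked _<_ xs → Linked _<_ ys → ys ⊆ xs → ys ⊑ xs
sorted-⊆⇒⊑ {xs} {[]} _ _ _ = minimum xs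
sorted-⊆⇒⊑ {[]} {y ∷ ys} _ _ ys⊆xs with ys⊆xs (here refl)
... | ()
sorted-⊆⇒⊑ {x ∷ xs} {y ∷ ys} sxs sys ys⊆xs with y ≟ x
... | yes refl = refl ∷ sorted-⊆⇒⊑ (Linked.tail sxs) (Linked.tail sys) ys⊆xs′
  where
  ys⊆xs′ : ys ⊆ xs
  ys⊆xs′ z∈ = ∈-∷⁻ (ys⊆xs (there z∈)) (λ { refl → <-irrefl refl (sorted-head-< sys z∈) })
... | no y≢x = x ∷ʳ sorted-⊆⇒⊑ (Linked.tail sxs) sys y∷ys⊆xs′
  where
  y∈xs′ : y ∈ xs
  y∈xs′ = ∈-∷⁻ (ys⊆xs (here refl)) y≢x
  y∷ys⊆xs′ : y ∷ ys ⊆ xs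
  y∷ys⊆xs′ z∈ = ∈-∷⁻ (ys⊆xs z∈) λ { refl →
    <-irrefl refl (<-≤-trans (sorted-head-< sxs y∈xs′) (sorted-head-≤ sys z∈)) }

sorted-⊆-antisym : ∀ {xs ys} → Linked _<_ xs → Linked _<_ ys → xs ⊆ ys → ys ⊆ xs → xs ≡ ys
sorted-⊆-antisym sxs sys xs⊆ys ys⊆xs =
  ⊆-antisym (sorted-⊆⇒⊑ sys sxs xs⊆ys) (sorted-⊆⇒⊑ sxs sys ys⊆xs)

upTo-sorted : ∀ n → Linked _<_ (upTo n)
upTo-sorted n = applyUpTo⁺₂ id n (λ i → n<1+n i)

oneTo : ℕ → List ℕ
oneTo = applyUpTo suc

length-oneTo : ∀ n → length (oneTo n) ≡ n
length-oneTo = length-applyUpTo suc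

∈-oneTo⁺ : ∀ {n x} → 1 ≤ x → x ≤ n → x ∈ oneTo n
∈-oneTo⁺ {x = suc i} _ i<n = ∈-applyUpTo⁺ suc i<n

∈-oneTo⁻ : ∀ {n x} → x ∈ oneTo n → 1 ≤ x × x ≤ n
∈-oneTo⁻ x∈ with ∈-applyUpTo⁻ suc x∈
... | _ , i<n , refl = s≤s z≤n , i<n

oneTo-sorted : ∀ n → Linked _<_ (oneTo n)
oneTo-sorted n = applyUpTo⁺₂ suc n (λ i → n<1+n (suc i))

oneTo-unique : ∀ n → Unique (oneTo n)
oneTo-unique n = sorted⇒unique (oneTo-sorted n)

-- Left elements and their gcd

gcdList-∣ : ∀ {x xs} → x ∈ xs → gcdList xs ∣ x
gcdList-∣ {xs = y ∷ ys} (here refl) = gcd[m,n]∣m y (gcdList ys)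
gcdList-∣ {xs = y ∷ ys} (there x∈) = ∣-trans (gcd[m,n]∣n y (gcdList ys)) (gcdList-∣ x∈)

gcdList-≤ : ∀ {n} xs → (∀ {x} → x ∈ xs → x ≤ n) → gcdList xs ≤ n
gcdList-≤ [] _ = z≤n
gcdList-≤ (zero ∷ xs) ≤n =
  ≤-trans (≤-reflexive (gcd-identityˡ (gcdList xs))) (gcdList-≤ xs (≤n ∘ there))
gcdList-≤ (suc x ∷ xs) ≤n = ≤-trans (∣⇒≤ (gcd[m,n]∣m (suc x) (gcdList xs))) (≤n (here refl))

leftElements-frobenius : ∀ {gs F} → frobenius gs ≡ just F → leftElements gs ≡ leftElementsBelow gs F
leftElements-frobenius {gs} frob with frobenius gs | frob
... | just _ | refl = refl

module _ {gs F} (frob : frobenius gs ≡ just F) where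

  ∈-leftElements⁺ : ∀ {x} → x < F → x ∉ gs → x ∈ leftElements gs
  ∈-leftElements⁺ x<F x∉gs = subst (_ ∈_) (sym (leftElements-frobenius frob))
    (∈-filter⁺ (λ s → ¬? (s ∈? gs)) (∈-upTo⁺ x<F) x∉gs)

  ∈-leftElements⁻ : ∀ {x} → x ∈ leftElements gs → x < F
  ∈-leftElements⁻ x∈ = ∈-upTo⁻ (proj₁ (∈-filter⁻ (λ s → ¬? (s ∈? gs))
    (subst (_ ∈_) (leftElements-frobenius frob) x∈)))

  gcdLeft-∣ : ∀ {x} → x < F → x ∉ gs → gcdLeft gs ∣ x
  gcdLeft-∣ x<F x∉gs = gcdList-∣ (∈-leftElements⁺ x<F x∉gs)

  gcdLeft-≤ : gcdLeft gs ≤ F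
  gcdLeft-≤ = gcdList-≤ (leftElements gs) (<⇒≤ ∘ ∈-leftElements⁻)

-- Gaps of a numerical semigroup

-- The reflection a ↦ y ∸ a maps the a ∈ 1..y outside P injectively into P.
module _ {P : ℕ → Set} (P? : Decidable P) (∁-closed : ∀ a b → ¬ P a → ¬ P b → ¬ P (a + b)) where

  ≤2*length-filter-oneTo : ∀ {y} → P y → y ≤ 2 * length (filter P? (oneTo y))
  ≤2*length-filter-oneTo {y} Py = begin
    y         ≡⟨ trans (length-filter-∁ P? (oneTo y)) (length-oneTo y) ⟨
    #P + #∁P  ≤⟨ +-monoʳ-≤ #P #∁P≤#P ⟩
    #P + #P   ≡⟨ cong (#P +_) (+-identityʳ #P) ⟨
    2 * #P    ∎
    where
    open ≤-Reasoning
    Ps  = filter P? (oneTo y)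
    ∁Ps = filter (∁? P?) (oneTo y)
    #P  = length Ps
    #∁P = length ∁Ps

    ∈∁Ps⇒<y : ∀ {a} → a ∈ ∁Ps → a < y × ¬ P a
    ∈∁Ps⇒<y a∈ with ∈-filter⁻ (∁? P?) a∈
    ... | a∈oneTo , ¬Pa = ≤∧≢⇒< (proj₂ (∈-oneTo⁻ a∈oneTo)) (λ { refl → ¬Pa Py }) , ¬Pa

    reflect∈Ps : ∀ {a} → a ∈ ∁Ps → y ∸ a ∈ Ps
    reflect∈Ps {a} a∈ with ∈∁Ps⇒<y a∈ | P? (y ∸ a)
    ... | a<y , _   | yes Py∸a = ∈-filter⁺ P? (∈-oneTo⁺ (m<n⇒0<n∸m a<y) (m∸n≤m y a)) Py∸a
    ... | a<y , ¬Pa | no ¬Py∸a =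
      ⊥-elim (∁-closed a (y ∸ a) ¬Pa ¬Py∸a (subst P (sym (m+[n∸m]≡n (<⇒≤ a<y))) Py))

    reflect-injective : ∀ {a b} → a ∈ ∁Ps → b ∈ ∁Ps → y ∸ a ≡ y ∸ b → a ≡ b
    reflect-injective a∈ b∈ =
      ∸-cancelˡ-≡ (<⇒≤ (proj₁ (∈∁Ps⇒<y a∈))) (<⇒≤ (proj₁ (∈∁Ps⇒<y b∈)))

    reflect⊆Ps : map (y ∸_) ∁Ps ⊆ Ps
    reflect⊆Ps z∈ with ∈-map⁻ (y ∸_) z∈
    ... | a , a∈ , refl = reflect∈Ps a∈

    #∁P≤#P : #∁P ≤ #P
    #∁P≤#P = begin
      #∁P                     ≡⟨ length-map (y ∸_) ∁Ps ⟨
      length (map (y ∸_) ∁Ps) ≤⟨ Unique-⊆⇒length-≤ reflect-unique reflect⊆Ps ⟩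
      #P                      ∎
      where
      reflect-unique = Unique-map⁺-on reflect-injective (Unique.filter⁺ (∁? P?) (oneTo-unique y))

module _ {gs} (ns : IsNumericalSemigroup gs) where

  gap-positive : ∀ {x} → x ∈ gs → 1 ≤ x
  gap-positive {zero} 0∈gs = ⊥-elim (proj₁ (proj₂ ns) 0∈gs)
  gap-positive {suc x} _ = s≤s z≤n

  gap-≤-2*genus : ∀ {x} → x ∈ gs → x ≤ 2 * genus gs
  gap-≤-2*genus {x} x∈gs = ≤-trans (≤2*length-filter-oneTo (_∈? gs) (proj₂ (proj₂ ns)) x∈gs)
    (*-monoʳ-≤ 2 (Unique-⊆⇒length-≤ (Unique.filter⁺ (_∈? gs) (oneTo-unique x))
                                     (proj₂ ∘ ∈-filter⁻ (_∈? gs) {xs = oneTo x})))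

  gap-multiples-≤2*length : ∀ {d y} → d * y ∈ gs →
    y ≤ 2 * length (filter (λ a → d * a ∈? gs) (oneTo y))
  gap-multiples-≤2*length {d} = ≤2*length-filter-oneTo (λ a → d * a ∈? gs) λ a b da∉gs db∉gs →
    proj₂ (proj₂ ns) (d * a) (d * b) da∉gs db∉gs ∘ subst (_∈ gs) (*-distribˡ-+ d a b)

AddClosedComplement : List ℕ → Set
AddClosedComplement gs = ∀ a b → a ∉ gs → b ∉ gs → (a + b) ∉ gs

-- A bounded, hence decidable, reformulation of AddClosedComplement.
GapsSplit : List ℕ → Set
GapsSplit gs = All (λ c → All (λ a → a ∈ gs ⊎ c ∸ a ∈ gs) (upTo (suc c))) gs

closed⇒GapsSplit : ∀ {gs} → AddClosedComplement gs → GapsSplit gs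
closed⇒GapsSplit {gs} closed =
  All.tabulate λ c∈gs → All.tabulate λ a∈ → split c∈gs (≤-pred (∈-upTo⁻ a∈))
  where
  split : ∀ {c a} → c ∈ gs → a ≤ c → a ∈ gs ⊎ c ∸ a ∈ gs
  split {c} {a} c∈gs a≤c with a ∈? gs | (c ∸ a) ∈? gs
  ... | yes a∈gs | _           = inj₁ a∈gs
  ... | no _     | yes c∸a∈gs = inj₂ c∸a∈gs
  ... | no a∉gs  | no c∸a∉gs  =
    ⊥-elim (closed a (c ∸ a) a∉gs c∸a∉gs (subst (_∈ gs) (sym (m+[n∸m]≡n a≤c)) c∈gs))

GapsSplit⇒closed : ∀ {gs} → GapsSplit gs → AddClosedComplement gs
GapsSplit⇒closed {gs} split a b a∉gs b∉gs a+b∈gs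
  with All.lookup (All.lookup split a+b∈gs) (∈-upTo⁺ (s≤s (m≤m+n a b)))
... | inj₁ a∈gs = a∉gs a∈gs
... | inj₂ b∈gs = b∉gs (subst (_∈ gs) (m+n∸m≡n a b) b∈gs)

IsNumericalSemigroup? : Decidable IsNumericalSemigroup
IsNumericalSemigroup? gs =
  map′ (λ (s , z , c) → s , z , GapsSplit⇒closed c) (λ (s , z , c) → s , z , closed⇒GapsSplit c)
    (linked? _<?_ gs ×-dec ¬? (0 ∈? gs) ×-dec gapsSplit?)
  where
  gapsSplit? : Dec (GapsSplit gs)
  gapsSplit? = all? (λ c → all? (λ a → a ∈? gs ⊎-dec (c ∸ a) ∈? gs) (upTo (suc c))) gs

NSGenus? : ∀ g → Decidable (NSGenus g)
NSGenus? g gs = IsNumericalSemigroup? gs ×-dec (genus gs ≟ g)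

semigroupsOfGenus : ℕ → List (List ℕ)
semigroupsOfGenus g = filter (NSGenus? g) (sublists (oneTo (2 * g)))

semigroupsOfGenus-enumerates : ∀ g → Enumerates (NSGenus g) (semigroupsOfGenus g)
semigroupsOfGenus-enumerates g = Unique.filter⁺ (NSGenus? g) (sublists-unique (oneTo-unique (2 * g))) ,
  λ gs → mk⇔ (proj₂ ∘ ∈-filter⁻ (NSGenus? g) {xs = sublists (oneTo (2 * g))})
             (λ nsg → ∈-filter⁺ (NSGenus? g) (∈-candidates nsg) nsg)
  where
  ∈-candidates : ∀ {gs} → NSGenus g gs → gs ∈ sublists (oneTo (2 * g))
  ∈-candidates (ns , refl) = ∈-sublists⁺ (sorted-⊆⇒⊑ (oneTo-sorted _) (proj₁ ns) λ x∈gs →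
    ∈-oneTo⁺ (gap-positive ns x∈gs) (gap-≤-2*genus ns x∈gs))

filter-enumerates : ∀ {P Q : List ℕ → Set} {xs} (Q? : Decidable Q) →
  Enumerates P xs → Enumerates (λ x → P x × Q x) (filter Q? xs)
filter-enumerates Q? (unique , ∈⇔P) = Unique.filter⁺ Q? unique , λ x → mk⇔
  (λ x∈ → let x∈xs , Qx = ∈-filter⁻ Q? x∈ in Equivalence.to (∈⇔P x) x∈xs , Qx)
  (λ (Px , Qx) → ∈-filter⁺ Q? (Equivalence.from (∈⇔P x) Px) Qx)

-- Many semigroups with gcd 1

fib : ℕ → ℕ
fib 0 = 0
fib 1 = 1
fib (suc (suc n)) = fib (suc n) + fib n

-- A composition into parts 1 and 2 is a list of parts, true standing for 1 and false for 2.
weight : List Bool → ℕ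
weight []          = 0
weight (true ∷ u)  = 1 + weight u
weight (false ∷ u) = 2 + weight u

compositions : ℕ → List (List Bool)
compositions 0 = [] ∷ []
compositions 1 = (true ∷ []) ∷ []
compositions (suc (suc n)) = map (true ∷_) (compositions (suc n)) ++ map (false ∷_) (compositions n)

length-compositions : ∀ n → length (compositions n) ≡ fib (suc n)
length-compositions 0 = refl
length-compositions 1 = refl
length-compositions (suc (suc n)) = begin
  length (map (true ∷_) (compositions (suc n)) ++ map (false ∷_) (compositions n))
    ≡⟨ length-++ (map (true ∷_) (compositions (suc n))) ⟩
  length (map (true ∷_) (compositions (suc n))) + length (map (false ∷_) (compositions n))
    ≡⟨ cong₂ _+_ (length-map (true ∷_) (compositions (suc n))) (length-map (false ∷_) (compositions n)) ⟩
  length (compositions (suc n)) + length (compositions n)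
    ≡⟨ cong₂ _+_ (length-compositions (suc n)) (length-compositions n) ⟩
  fib (suc (suc n)) + fib (suc n) ∎
  where open ≡-Reasoning

compositions-unique : ∀ n → Unique (compositions n)
compositions-unique 0 = All.[] ∷ []
compositions-unique 1 = All.[] ∷ []
compositions-unique (suc (suc n)) =
  Unique.++⁺ (Unique.map⁺ ∷-injectiveʳ (compositions-unique (suc n)))
             (Unique.map⁺ ∷-injectiveʳ (compositions-unique n)) disjoint
  where
  disjoint : ∀ {v} → v ∈ map (true ∷_) (compositions (suc n)) × v ∈ map (false ∷_) (compositions n) → ⊥
  disjoint (v∈₁ , v∈₂) with ∈-map⁻ (true ∷_) v∈₁ | ∈-map⁻ (false ∷_) v∈₂
  ... | _ , _ , refl | _ , _ , ()

weight-compositions : ∀ n {u} → u ∈ compositions n → weight u ≡ n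
weight-compositions 0 (here refl) = refl
weight-compositions 1 (here refl) = refl
weight-compositions (suc (suc n)) u∈ with ∈-++⁻ (map (true ∷_) (compositions (suc n))) u∈
... | inj₁ u∈₁ with ∈-map⁻ (true ∷_) u∈₁
...   | v , v∈ , refl = cong suc (weight-compositions (suc n) v∈)
weight-compositions (suc (suc n)) u∈ | inj₂ u∈₂ with ∈-map⁻ (false ∷_) u∈₂
...   | v , v∈ , refl = cong (2 +_) (weight-compositions n v∈)

tailGaps : List Bool → ℕ → List ℕ
tailGaps []          p = p ∷ []
tailGaps (true ∷ u)  p = tailGaps u (suc p)
tailGaps (false ∷ u) p = p ∷ tailGaps u (suc p)

tailGaps-bounds : ∀ u {p z} → z ∈ tailGaps u p → p ≤ z × z ≤ p + length u
tailGaps-bounds [] {p} (here refl) = ≤-refl , ≤-reflexive (sym (+-identityʳ p))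
tailGaps-bounds (false ∷ u) {p} (here refl) = ≤-refl , m≤m+n p _
tailGaps-bounds (true ∷ u) {p} z∈ with tailGaps-bounds u z∈
... | p<z , z≤ = <⇒≤ p<z , ≤-trans z≤ (≤-reflexive (sym (+-suc p (length u))))
tailGaps-bounds (false ∷ u) {p} (there z∈) with tailGaps-bounds u z∈
... | p<z , z≤ = <⇒≤ p<z , ≤-trans z≤ (≤-reflexive (sym (+-suc p (length u))))

tailGaps-sorted : ∀ u p → Linked _<_ (tailGaps u p)
tailGaps-sorted [] p = [-]
tailGaps-sorted (true ∷ u) p = tailGaps-sorted u (suc p)
tailGaps-sorted (false ∷ u) p =
  sorted-++⁺ [-] (tailGaps-sorted u (suc p)) λ { (here refl) z∈ → proj₁ (tailGaps-bounds u z∈) }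

tailGaps-last : ∀ u p → last (tailGaps u p) ≡ just (p + length u)
tailGaps-last [] p = cong just (sym (+-identityʳ p))
tailGaps-last (true ∷ u) p = trans (tailGaps-last u (suc p)) (cong just (sym (+-suc p (length u))))
tailGaps-last (false ∷ u) p = trans (last-∷ p (tailGaps u (suc p)) (tailGaps-last u (suc p)))
                                    (cong just (sym (+-suc p (length u))))

length-tailGaps : ∀ u p → length u + length (tailGaps u p) ≡ suc (weight u)
length-tailGaps [] p = refl
length-tailGaps (true ∷ u) p = cong suc (length-tailGaps u (suc p))
length-tailGaps (false ∷ u) p = trans (+-suc (suc (length u)) _) (cong (2 +_) (length-tailGaps u (suc p)))

tailGaps-injective : ∀ {u v} p → length u ≡ length v → tailGaps u p ≡ tailGaps v p → u ≡ v
tailGaps-injective {[]} {[]} _ _ _ = refl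
tailGaps-injective {true ∷ u} {true ∷ v} p len eq =
  cong (true ∷_) (tailGaps-injective (suc p) (suc-injective len) eq)
tailGaps-injective {false ∷ u} {false ∷ v} p len eq =
  cong (false ∷_) (tailGaps-injective (suc p) (suc-injective len) (∷-injectiveʳ eq))
tailGaps-injective {true ∷ u} {false ∷ v} p _ eq =
  ⊥-elim (<-irrefl refl (proj₁ (tailGaps-bounds u (subst (p ∈_) (sym eq) (here refl)))))
tailGaps-injective {false ∷ u} {true ∷ v} p _ eq =
  ⊥-elim (<-irrefl refl (proj₁ (tailGaps-bounds v (subst (p ∈_) eq (here refl)))))

-- With L = length u and m = L + 3: the gaps are 1, …, m − 1, the elements of m + 2, …, 2m − 2
-- marked false in u, and the Frobenius number 2m − 1.
familyGaps : List Bool → List ℕ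
familyGaps u = oneTo (length u + 2) ++ tailGaps u (length u + 5)

module Family (u : List Bool) where

  private
    L  = length u
    gs = familyGaps u

  F : ℕ
  F = (L + 5) + L

  low-∈ : ∀ {z} → 1 ≤ z → z ≤ L + 2 → z ∈ gs
  low-∈ 1≤z z≤ = ∈-++⁺ˡ (∈-oneTo⁺ 1≤z z≤)

  gap-low⊎high : ∀ {z} → z ∈ gs → 1 ≤ z × z ≤ L + 2 ⊎ L + 5 ≤ z × z ≤ F
  gap-low⊎high z∈ with ∈-++⁻ (oneTo (L + 2)) z∈
  ... | inj₁ z∈low  = inj₁ (∈-oneTo⁻ z∈low)
  ... | inj₂ z∈tail = inj₂ (tailGaps-bounds u z∈tail)

  gap-bounds : ∀ {z} → z ∈ gs → 1 ≤ z × z ≤ F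
  gap-bounds z∈ with gap-low⊎high z∈
  ... | inj₁ (1≤z , z≤) =
    1≤z , ≤-trans z≤ (≤-trans (+-monoʳ-≤ L (s≤s (s≤s z≤n))) (m≤m+n (L + 5) L))
  ... | inj₂ (L+5≤z , z≤) = ≤-trans (s≤s z≤n) (≤-trans (m≤n+m 5 L) L+5≤z) , z≤

  middle-∉ : ∀ {z} → L + 2 < z → z < L + 5 → z ∉ gs
  middle-∉ L+2<z z<L+5 z∈ with gap-low⊎high z∈
  ... | inj₁ (_ , z≤) = <-irrefl refl (<-≤-trans L+2<z z≤)
  ... | inj₂ (L+5≤z , _) = <-irrefl refl (<-≤-trans z<L+5 L+5≤z)

  nonzero-element-≥ : ∀ {a} → a ∉ gs → 1 ≤ a → L + 3 ≤ a
  nonzero-element-≥ {a} a∉ 1≤a with a <? L + 3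
  ... | yes a<L+3 = ⊥-elim (a∉ (low-∈ 1≤a (≤-pred (≤-trans a<L+3 (≤-reflexive (+-suc L 2))))))
  ... | no a≮L+3 = ≮⇒≥ a≮L+3

  closed : AddClosedComplement gs
  closed zero b _ b∉ = b∉
  closed (suc a) zero a∉ _ = subst (_∉ gs) (sym (+-identityʳ (suc a))) a∉
  closed (suc a) (suc b) a∉ b∉ a+b∈ = <-irrefl refl (begin-strict
    F                  <⟨ ≤-reflexive (1+F≡2[L+3] L) ⟩
    (L + 3) + (L + 3)  ≤⟨ +-mono-≤ (element-≥ a∉) (element-≥ b∉) ⟩
    suc a + suc b      ≤⟨ proj₂ (gap-bounds a+b∈) ⟩
    F                  ∎)
    where
    open ≤-Reasoning
    element-≥ : ∀ {a} → suc a ∉ gs → L + 3 ≤ suc a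
    element-≥ a∉ = nonzero-element-≥ a∉ (s≤s z≤n)
    1+F≡2[L+3] : ∀ L → suc ((L + 5) + L) ≡ (L + 3) + (L + 3)
    1+F≡2[L+3] = solve-∀

  isNumericalSemigroup : IsNumericalSemigroup gs
  isNumericalSemigroup = sorted-++⁺ (oneTo-sorted (L + 2)) (tailGaps-sorted u (L + 5)) low<tail ,
                         (λ 0∈ → <-irrefl refl (proj₁ (gap-bounds 0∈))) , closed
    where
    low<tail : ∀ {a b} → a ∈ oneTo (L + 2) → b ∈ tailGaps u (L + 5) → a < b
    low<tail a∈ b∈ = ≤-<-trans (proj₂ (∈-oneTo⁻ a∈))
      (<-≤-trans (+-monoʳ-< L (s<s (s<s z<s))) (proj₁ (tailGaps-bounds u b∈)))

  frobenius≡F : frobenius gs ≡ just F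
  frobenius≡F = last-++ (oneTo (L + 2)) (tailGaps-last u (L + 5))

  genus≡weight+3 : genus gs ≡ weight u + 3
  genus≡weight+3 = begin
    length (oneTo (L + 2) ++ tailGaps u (L + 5))
      ≡⟨ length-++ (oneTo (L + 2)) ⟩
    length (oneTo (L + 2)) + length (tailGaps u (L + 5))
      ≡⟨ cong (_+ length (tailGaps u (L + 5))) (length-oneTo (L + 2)) ⟩
    (L + 2) + length (tailGaps u (L + 5))
      ≡⟨ swap-2 L (length (tailGaps u (L + 5))) ⟩
    (L + length (tailGaps u (L + 5))) + 2
      ≡⟨ cong (_+ 2) (length-tailGaps u (L + 5)) ⟩
    suc (weight u) + 2
      ≡⟨ +-suc (weight u) 2 ⟨
    weight u + 3 ∎
    where
    open ≡-Reasoning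
    swap-2 : ∀ a b → (a + 2) + b ≡ (a + b) + 2
    swap-2 = solve-∀

  gcdLeft≡1 : gcdLeft gs ≡ 1
  gcdLeft≡1 = ∣1⇒≡1 (∣m+n∣m⇒∣n (subst (gcdLeft gs ∣_) (sym (+-assoc L 3 1)) (left-∣ {4} 2<4 4<5))
                                (left-∣ {3} 2<3 3<5))
    where
    left-∣ : ∀ {i} → 2 < i → i < 5 → gcdLeft gs ∣ L + i
    left-∣ 2<i i<5 = gcdLeft-∣ frobenius≡F (<-≤-trans (+-monoʳ-< L i<5) (m≤m+n (L + 5) L))
                                           (middle-∉ (+-monoʳ-< L 2<i) (+-monoʳ-< L i<5))
    2<3 = s<s (s<s z<s)
    2<4 = s<s (s<s z<s)
    3<5 = s<s (s<s (s<s z<s))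
    4<5 = s<s (s<s (s<s (s<s z<s)))

familyGaps-length-mono : ∀ {u v} → familyGaps u ≡ familyGaps v → length u ≤ length v
familyGaps-length-mono {u} {v} eq with length u ≤? length v
... | yes u≤v = u≤v
... | no u≰v = ⊥-elim (Family.middle-∉ v (+-monoʳ-< Lv (n<1+n 2)) (+-monoʳ-< Lv (s<s (s<s (s<s z<s))))
                        (subst (Lv + 3 ∈_) eq (Family.low-∈ u 1≤Lv+3 Lv+3≤Lu+2)))
  where
  Lv = length v
  1≤Lv+3 : 1 ≤ Lv + 3
  1≤Lv+3 = ≤-trans (s≤s z≤n) (m≤n+m 3 Lv)
  Lv+3≤Lu+2 : Lv + 3 ≤ length u + 2
  Lv+3≤Lu+2 = ≤-trans (≤-reflexive (+-suc Lv 2)) (+-monoˡ-≤ 2 (≰⇒> u≰v))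

familyGaps-injective : ∀ {u v} → familyGaps u ≡ familyGaps v → u ≡ v
familyGaps-injective {u} {v} eq = tailGaps-injective (length u + 5) len
  (++-cancelˡ (oneTo (length u + 2)) _ _ (trans eq (cong (λ n → familyGaps′ n v) (sym len))))
  where
  familyGaps′ : ℕ → List Bool → List ℕ
  familyGaps′ n v = oneTo (n + 2) ++ tailGaps v (n + 5)
  len : length u ≡ length v
  len = ≤-antisym (familyGaps-length-mono {u} {v} eq) (familyGaps-length-mono {v} {u} (sym eq))

fib-≤-#good : ∀ g {as} → Enumerates (λ gs → NSGenus g gs × gcdLeft gs ≡ 1) as →
  fib (g ∸ 2) ≤ length as
fib-≤-#good 0 _ = z≤n
fib-≤-#good 1 _ = z≤n
fib-≤-#good 2 _ = z≤n
fib-≤-#good (suc (suc (suc n))) {as} (_ , ∈as⇔) = begin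
  fib (suc n)                              ≡⟨ length-compositions n ⟨
  length (compositions n)                  ≡⟨ length-map familyGaps (compositions n) ⟨
  length (map familyGaps (compositions n)) ≤⟨ Unique-⊆⇒length-≤ family-unique family⊆as ⟩
  length as                                ∎
  where
  open ≤-Reasoning
  family-unique = Unique.map⁺ familyGaps-injective (compositions-unique n)
  family⊆as : map familyGaps (compositions n) ⊆ as
  family⊆as gs∈ with ∈-map⁻ familyGaps gs∈
  ... | u , u∈ , refl = Equivalence.from (∈as⇔ (familyGaps u)) ((isNumericalSemigroup , genus≡) , gcdLeft≡1)
    where
    open Family u
    genus≡ : genus (familyGaps u) ≡ suc (suc (suc n))
    genus≡ = trans genus≡weight+3 (trans (cong (_+ 3) (weight-compositions n u∈)) (+-comm n 3))

-- Few semigroups with gcd ≠ 1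

m*n≤o⇒n≤o/m : ∀ {n o} m .{{_ : NonZero m}} → m * n ≤ o → n ≤ o / m
m*n≤o⇒n≤o/m {n} {o} m mn≤o = begin
  n          ≡⟨ m*n/n≡m n m ⟨
  n * m / m  ≤⟨ /-monoˡ-≤ m (≤-trans (≤-reflexive (*-comm n m)) mn≤o) ⟩
  o / m      ∎
  where open ≤-Reasoning

n≢0⇒n≢1⇒2≤n : ∀ {n} → n ≢ 0 → n ≢ 1 → 2 ≤ n
n≢0⇒n≢1⇒2≤n {0} n≢0 _ = ⊥-elim (n≢0 refl)
n≢0⇒n≢1⇒2≤n {1} _ n≢1 = ⊥-elim (n≢1 refl)
n≢0⇒n≢1⇒2≤n {suc (suc n)} _ _ = s≤s (s≤s z≤n)

-- The gaps of a semigroup whose left elements are all divisible by D, with Frobenius number F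
-- and with D * Y its gaps below F that are divisible by D.
DecodedGap : ℕ → ℕ → List ℕ → ℕ → Set
DecodedGap D F Y x = x ≡ F ⊎ ¬ D ∣ x ⊎ x ∈ map (D *_) Y

decodedGap? : ∀ D F Y → Decidable (DecodedGap D F Y)
decodedGap? D F Y x = x ≟ F ⊎-dec ¬? (D ∣? x) ⊎-dec x ∈? map (D *_) Y

decode : ℕ → ℕ → List ℕ → List ℕ
decode D F Y = filter (decodedGap? D F Y) (oneTo F)

module BadSemigroup {gs} (ns : IsNumericalSemigroup gs) {F} (frob : frobenius gs ≡ just F)
                    (bad : gcdLeft gs ≢ 1) where

  D : ℕ
  D = gcdLeft gs

  F∈gs : F ∈ gs
  F∈gs = last-∈ gs frob

  gap-≤-F : ∀ {x} → x ∈ gs → x ≤ F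
  gap-≤-F = sorted-≤-last (proj₁ ns) frob

  ∤-∈ : ∀ {x} → x ≤ F → ¬ D ∣ x → x ∈ gs
  ∤-∈ {x} x≤F D∤x with x ∈? gs | x ≟ F
  ... | yes x∈gs | _        = x∈gs
  ... | no _     | yes refl = F∈gs
  ... | no x∉gs  | no x≢F   = ⊥-elim (D∤x (gcdLeft-∣ frob (≤∧≢⇒< x≤F x≢F) x∉gs))

  D≢0 : ∀ {y} → D * y ∈ gs → D ≢ 0
  D≢0 {y} Dy∈gs D≡0 = proj₁ (proj₂ ns) (subst (λ d → d * y ∈ gs) D≡0 Dy∈gs)

  D*a+1-∤ : ∀ a → ¬ D ∣ D * a + 1
  D*a+1-∤ a D∣ = bad (∣1⇒≡1 (∣m+n∣m⇒∣n D∣ (m∣m*n a)))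

  D*a+1<D*y : ∀ {a y} → D * y ∈ gs → a < y → D * a + 1 < D * y
  D*a+1<D*y {a} {y} Dy∈gs a<y = begin-strict
    D * a + 1  <⟨ +-monoʳ-< (D * a) (n≢0⇒n≢1⇒2≤n (D≢0 Dy∈gs) bad) ⟩
    D * a + D  ≡⟨ trans (+-comm (D * a) D) (sym (*-suc D a)) ⟩
    D * suc a  ≤⟨ *-monoʳ-≤ D a<y ⟩
    D * y      ∎
    where open ≤-Reasoning

  gapMultipliers : ℕ → List ℕ
  gapMultipliers y = filter (λ a → D * a ∈? gs) (oneTo y)

  -- F, the gaps D * a with a ≤ y, and the numbers D * a + 1 with a < y are distinct gaps.
  gaps-below-multiple : ∀ {y} → D * y ∈ gs → D * y < F → suc (length (gapMultipliers y) + y) ≤ genus gs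
  gaps-below-multiple {y} Dy∈gs Dy<F = begin
    suc (length M + y)
      ≡⟨ cong suc (cong₂ _+_ (length-map (D *_) M) (trans (length-map _ (upTo y)) (length-upTo y))) ⟨
    suc (length multiples + length shifted) ≡⟨ cong suc (length-++ multiples) ⟨
    length witnesses                        ≤⟨ Unique-⊆⇒length-≤ witnesses-unique witnesses⊆gs ⟩
    genus gs                                ∎
    where
    open ≤-Reasoning
    instance
      D-nonZero : NonZero D
      D-nonZero = ≢-nonZero (D≢0 Dy∈gs)

    M = gapMultipliers y
    multiples = map (D *_) M
    shifted   = map (λ a → D * a + 1) (upTo y)
    witnesses = F ∷ multiples ++ shifted

    multiples-gaps : ∀ {x} → x ∈ multiples → x ∈ gs × D ∣ x × x < F
    multiples-gaps x∈ with ∈-map⁻ (D *_) x∈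
    ... | a , a∈M , refl with ∈-filter⁻ (λ a → D * a ∈? gs) {xs = oneTo y} a∈M
    ...   | a∈oneTo , Da∈gs =
      Da∈gs , m∣m*n a , ≤-<-trans (*-monoʳ-≤ D (proj₂ (∈-oneTo⁻ a∈oneTo))) Dy<F

    shifted-gaps : ∀ {x} → x ∈ shifted → x ∈ gs × ¬ D ∣ x × x < F
    shifted-gaps x∈ with ∈-map⁻ (λ a → D * a + 1) x∈
    ... | a , a∈ , refl = ∤-∈ (<⇒≤ x<F) (D*a+1-∤ a) , D*a+1-∤ a , x<F
      where x<F = <-trans (D*a+1<D*y Dy∈gs (∈-upTo⁻ a∈)) Dy<F

    below-F : ∀ {x} → x ∈ multiples ++ shifted → x ∈ gs × x < F
    below-F x∈ with ∈-++⁻ multiples x∈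
    ... | inj₁ x∈m = proj₁ (multiples-gaps x∈m) , proj₂ (proj₂ (multiples-gaps x∈m))
    ... | inj₂ x∈s = proj₁ (shifted-gaps x∈s) , proj₂ (proj₂ (shifted-gaps x∈s))

    witnesses⊆gs : witnesses ⊆ gs
    witnesses⊆gs (here refl) = F∈gs
    witnesses⊆gs (there x∈) = proj₁ (below-F x∈)

    witnesses-unique : Unique witnesses
    witnesses-unique = All.tabulate (λ x∈ F≡x → <-irrefl (sym F≡x) (proj₂ (below-F x∈))) ∷
      Unique.++⁺ (Unique.map⁺ (*-cancelˡ-≡ _ _ D) (Unique.filter⁺ (λ a → D * a ∈? gs) (oneTo-unique y)))
                 (Unique.map⁺ (*-cancelˡ-≡ _ _ D ∘ +-cancelʳ-≡ 1 _ _) (sorted⇒unique (upTo-sorted y)))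
                 λ (x∈m , x∈s) → proj₁ (proj₂ (shifted-gaps x∈s)) (proj₁ (proj₂ (multiples-gaps x∈m)))

  gap-multiple-small : ∀ {y} → D * y ∈ gs → D * y < F → 3 * y + 2 ≤ 2 * genus gs
  gap-multiple-small {y} Dy∈gs Dy<F = begin
    3 * y + 2           ≡⟨ rearrange y ⟩
    y + 2 * suc y       ≤⟨ +-monoˡ-≤ (2 * suc y) (gap-multiples-≤2*length ns {D} Dy∈gs) ⟩
    2 * #M + 2 * suc y  ≡⟨ factor #M y ⟩
    2 * suc (#M + y)    ≤⟨ *-monoʳ-≤ 2 (gaps-below-multiple Dy∈gs Dy<F) ⟩
    2 * genus gs        ∎
    where
    open ≤-Reasoning
    #M = length (gapMultipliers y)
    rearrange : ∀ y → 3 * y + 2 ≡ y + 2 * suc y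
    rearrange = solve-∀
    factor : ∀ m y → 2 * m + 2 * suc y ≡ 2 * suc (m + y)
    factor = solve-∀

  smallGapMultipliers : List ℕ
  smallGapMultipliers = gapMultipliers (2 * genus gs / 3)

  gaps≡decode : gs ≡ decode D F smallGapMultipliers
  gaps≡decode = sorted-⊆-antisym (proj₁ ns) decode-sorted gs⊆decode decode⊆gs
    where
    Y = smallGapMultipliers

    decode-sorted : Linked _<_ (decode D F Y)
    decode-sorted = Linkedₚ.filter⁺ (decodedGap? D F Y) <-trans (oneTo-sorted F)

    gap-decoded : ∀ {x} → x ∈ gs → DecodedGap D F Y x
    gap-decoded {x} x∈gs with x ≟ F | D ∣? x
    ... | yes x≡F | _      = inj₁ x≡F
    ... | no _    | no D∤x = inj₂ (inj₁ D∤x)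
    ... | no x≢F  | yes (divides q refl) =
      inj₂ (inj₂ (subst (_∈ map (D *_) Y) (*-comm D q) (∈-map⁺ (D *_) q∈Y)))
      where
      Dq∈gs : D * q ∈ gs
      Dq∈gs = subst (_∈ gs) (*-comm q D) x∈gs
      1≤q : 1 ≤ q
      1≤q = n≢0⇒n>0 λ { refl → proj₁ (proj₂ ns) (subst (_∈ gs) (*-zeroʳ D) Dq∈gs) }
      3q≤2g : 3 * q ≤ 2 * genus gs
      3q≤2g = ≤-trans (m≤m+n (3 * q) 2)
        (gap-multiple-small Dq∈gs (subst (_< F) (*-comm q D) (≤∧≢⇒< (gap-≤-F x∈gs) x≢F)))
      q∈Y : q ∈ Y
      q∈Y = ∈-filter⁺ (λ y → D * y ∈? gs) (∈-oneTo⁺ 1≤q (m*n≤o⇒n≤o/m 3 3q≤2g)) Dq∈gs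

    gs⊆decode : gs ⊆ decode D F Y
    gs⊆decode x∈gs = ∈-filter⁺ (decodedGap? D F Y)
      (∈-oneTo⁺ (gap-positive ns x∈gs) (gap-≤-F x∈gs)) (gap-decoded x∈gs)

    decode⊆gs : decode D F Y ⊆ gs
    decode⊆gs x∈ with ∈-filter⁻ (decodedGap? D F Y) {xs = oneTo F} x∈
    ... | _       , inj₁ refl        = F∈gs
    ... | x∈oneTo , inj₂ (inj₁ D∤x)  = ∤-∈ (proj₂ (∈-oneTo⁻ x∈oneTo)) D∤x
    ... | _       , inj₂ (inj₂ x∈DY) with ∈-map⁻ (D *_) x∈DY
    ...   | y , y∈Y , refl = proj₂ (∈-filter⁻ (λ y → D * y ∈? gs) {xs = oneTo (2 * genus gs / 3)} y∈Y)

#codes : ℕ → ℕ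
#codes g = suc (2 * g) * (suc (2 * g) * 2 ^ (2 * g / 3))

uncurry₃ : ∀ {A B C R : Set} → (A → B → C → R) → A × B × C → R
uncurry₃ f (a , b , c) = f a b c

codes : ℕ → List (List ℕ)
codes g = map (uncurry₃ decode) (cartesianProduct R (cartesianProduct R (sublists (oneTo (2 * g / 3)))))
  where R = upTo (suc (2 * g))

bad-∈-codes : ∀ {g gs} → NSGenus g gs → gcdLeft gs ≢ 1 → gs ∈ codes g
bad-∈-codes {g} {[]} _ _ = ∈-map⁺ (uncurry₃ decode)
  (∈-cartesianProduct⁺ 0∈ (∈-cartesianProduct⁺ 0∈ (∈-sublists⁺ (minimum (oneTo (2 * g / 3))))))
  where
  0∈ : 0 ∈ upTo (suc (2 * g))
  0∈ = ∈-upTo⁺ (s≤s z≤n)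
bad-∈-codes {g} {gs@(x ∷ xs)} (ns , refl) bad with last-∷-just x xs
... | F , frob = subst (_∈ codes g) (sym gaps≡decode)
  (∈-map⁺ (uncurry₃ decode) (∈-cartesianProduct⁺ D∈ (∈-cartesianProduct⁺ F∈ Y∈)))
  where
  open BadSemigroup {gs} ns {F} frob bad
  F≤2g : F ≤ 2 * genus gs
  F≤2g = gap-≤-2*genus ns F∈gs
  F∈ : F ∈ upTo (suc (2 * genus gs))
  F∈ = ∈-upTo⁺ (s≤s F≤2g)
  D∈ : D ∈ upTo (suc (2 * genus gs))
  D∈ = ∈-upTo⁺ (s≤s (≤-trans (gcdLeft-≤ {gs} frob) F≤2g))
  Y∈ : smallGapMultipliers ∈ sublists (oneTo (2 * genus gs / 3))
  Y∈ = ∈-sublists⁺ (filter-Sublist (λ y → D * y ∈? gs) (⊆-refl {x = oneTo (2 * genus gs / 3)}))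

#bad-≤ : ∀ g {bs} → Enumerates (λ gs → NSGenus g gs × gcdLeft gs ≢ 1) bs → length bs ≤ #codes g
#bad-≤ g {bs} (unique , ∈bs⇔) = begin
  length bs
    ≤⟨ Unique-⊆⇒length-≤ unique bs⊆codes ⟩
  length (codes g)
    ≡⟨ length-map (uncurry₃ decode) (cartesianProduct R (cartesianProduct R Ys)) ⟩
  length (cartesianProduct R (cartesianProduct R Ys))
    ≡⟨ length-cartesianProduct R (cartesianProduct R Ys) ⟩
  length R * length (cartesianProduct R Ys)
    ≡⟨ cong (length R *_) (length-cartesianProduct R Ys) ⟩
  length R * (length R * length Ys)
    ≡⟨ cong₂ (λ r y → r * (r * y)) (length-upTo (suc (2 * g))) (length-sublists (oneTo (2 * g / 3))) ⟩
  suc (2 * g) * (suc (2 * g) * 2 ^ length (oneTo (2 * g / 3)))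
    ≡⟨ cong (λ n → suc (2 * g) * (suc (2 * g) * 2 ^ n)) (length-oneTo (2 * g / 3)) ⟩
  suc (2 * g) * (suc (2 * g) * 2 ^ (2 * g / 3)) ∎
  where
  open ≤-Reasoning
  R  = upTo (suc (2 * g))
  Ys = sublists (oneTo (2 * g / 3))
  bs⊆codes : bs ⊆ codes g
  bs⊆codes {gs} gs∈ = uncurry (bad-∈-codes {g} {gs}) (Equivalence.to (∈bs⇔ gs) gs∈)

-- Comparison of growth rates

fib-mono : ∀ n → fib n ≤ fib (suc n)
fib-mono zero = z≤n
fib-mono (suc n) = m≤m+n (fib (suc n)) (fib n)

fib-pos : ∀ n → 1 ≤ fib (suc n)
fib-pos zero = ≤-refl
fib-pos (suc n) = ≤-trans (fib-pos n) (m≤m+n _ _)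

17*fib≤fib+6 : ∀ n → 17 * fib (2 + n) ≤ fib (8 + n)
17*fib≤fib+6 n = begin
  17 * (a + b)              ≡⟨ split a b ⟩
  (17 * a + 13 * b) + 4 * b ≤⟨ +-monoʳ-≤ (17 * a + 13 * b) (*-monoʳ-≤ 4 (fib-mono n)) ⟩
  (17 * a + 13 * b) + 4 * a ≡⟨ unfold a b ⟨
  fib (8 + n)               ∎
  where
  open ≤-Reasoning
  a = fib (suc n)
  b = fib n
  split : ∀ a b → 17 * (a + b) ≡ (17 * a + 13 * b) + 4 * b
  split = solve-∀
  unfold : ∀ a b → let f₂ = a + b; f₃ = f₂ + a; f₄ = f₃ + f₂; f₅ = f₄ + f₃; f₆ = f₅ + f₄
                   in (f₆ + f₅) + f₆ ≡ (17 * a + 13 * b) + 4 * a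
  unfold = solve-∀

-- Opaque, so that the type checker never unfolds products of numerals into unary form.
opaque
  cube : ℕ → ℕ
  cube x = x * x * x

  cube-def : ∀ x → cube x ≡ x * x * x
  cube-def x = refl

  growthConstant : ℕ
  growthConstant = 1000000000

16*cube[6+x]≤17*cube[x] : ∀ x → 300 ≤ x → 16 * cube (6 + x) ≤ 17 * cube x
16*cube[6+x]≤17*cube[x] x 300≤x = begin
  16 * cube (6 + x)                                       ≡⟨ cong (16 *_) (cube-def (6 + x)) ⟩
  16 * ((6 + x) * (6 + x) * (6 + x))                      ≡⟨ expand x ⟩
  16 * (x * x * x) + (288 * (x * x) + (1728 * x + 3456))  ≤⟨ +-monoʳ-≤ (16 * (x * x * x)) excess≤x³ ⟩
  16 * (x * x * x) + x * x * x                            ≡⟨ collect x ⟩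
  17 * (x * x * x)                                        ≡⟨ cong (17 *_) (cube-def x) ⟨
  17 * cube x                                             ∎
  where
  open ≤-Reasoning
  expand : ∀ x → 16 * ((6 + x) * (6 + x) * (6 + x)) ≡ 16 * (x * x * x) + (288 * (x * x) + (1728 * x + 3456))
  expand = solve-∀
  collect : ∀ x → 16 * (x * x * x) + x * x * x ≡ 17 * (x * x * x)
  collect = solve-∀
  regroup : ∀ x → 1728 * x + 1728 * x ≡ 12 * (288 * x)
  regroup = solve-∀
  2≤x : 2 ≤ x
  2≤x = ≤-trans (s≤s (s≤s z≤n)) 300≤x
  288≤x : 288 ≤ x
  288≤x = ≤-trans (m≤m+n 288 12) 300≤x
  excess≤x³ : 288 * (x * x) + (1728 * x + 3456) ≤ x * x * x
  excess≤x³ = begin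
    288 * (x * x) + (1728 * x + 3456)
      ≤⟨ +-monoʳ-≤ (288 * (x * x)) (+-monoʳ-≤ (1728 * x) (*-monoʳ-≤ 1728 2≤x)) ⟩
    288 * (x * x) + (1728 * x + 1728 * x) ≡⟨ cong (288 * (x * x) +_) (regroup x) ⟩
    288 * (x * x) + 12 * (288 * x)
      ≤⟨ +-monoʳ-≤ (288 * (x * x)) (*-monoʳ-≤ 12 (*-monoˡ-≤ x 288≤x)) ⟩
    288 * (x * x) + 12 * (x * x)          ≡⟨ *-distribʳ-+ (x * x) 288 12 ⟨
    300 * (x * x)                         ≤⟨ *-monoˡ-≤ (x * x) 300≤x ⟩
    x * (x * x)                           ≡⟨ *-assoc x x x ⟨
    x * x * x                             ∎

2*[6+m]/3≡2*m/3+4 : ∀ m → 2 * (6 + m) / 3 ≡ 2 * m / 3 + 4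
2*[6+m]/3≡2*m/3+4 m = begin
  2 * (6 + m) / 3      ≡⟨ cong (_/ 3) (rearrange m) ⟩
  (2 * m + 4 * 3) / 3  ≡⟨ +-distrib-/-∣ʳ (2 * m) (divides 4 refl) ⟩
  2 * m / 3 + 4        ∎
  where
  open ≡-Reasoning
  rearrange : ∀ m → 2 * (6 + m) ≡ 2 * m + 4 * 3
  rearrange = solve-∀

-- At genus g = 4 + n: 2 ^ ⌊2g/3⌋, times the slack factor cube (300 + n), against fib (g − 2).
GrowthBound : ℕ → Set
GrowthBound n = 2 ^ (2 * (4 + n) / 3) * cube (300 + n) ≤ growthConstant * fib (2 + n)

opaque
  unfolding cube growthConstant

  growthBound-base : ∀ n → T (n <ᵇ 6) → GrowthBound n
  growthBound-base 0 _ = ≤ᵇ⇒≤ _ _ tt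
  growthBound-base 1 _ = ≤ᵇ⇒≤ _ _ tt
  growthBound-base 2 _ = ≤ᵇ⇒≤ _ _ tt
  growthBound-base 3 _ = ≤ᵇ⇒≤ _ _ tt
  growthBound-base 4 _ = ≤ᵇ⇒≤ _ _ tt
  growthBound-base 5 _ = ≤ᵇ⇒≤ _ _ tt

-- Six more steps multiply 2 ^ ⌊2g/3⌋ by 16, the cube by at most 17/16 and fib by at least 17.
growthBound-step : ∀ n → GrowthBound n → GrowthBound (6 + n)
growthBound-step n bound = begin
  2 ^ (2 * (6 + (4 + n)) / 3) * cube (306 + n)
    ≡⟨ cong (λ e → 2 ^ e * cube (306 + n)) (2*[6+m]/3≡2*m/3+4 (4 + n)) ⟩
  2 ^ (e + 4) * cube (306 + n)                 ≡⟨ cong (_* cube (306 + n)) (^-distribˡ-+-* 2 e 4) ⟩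
  2 ^ e * 16 * cube (306 + n)                  ≡⟨ *-assoc (2 ^ e) 16 _ ⟩
  2 ^ e * (16 * cube (306 + n))
    ≤⟨ *-monoʳ-≤ (2 ^ e) (16*cube[6+x]≤17*cube[x] (300 + n) (m≤m+n 300 n)) ⟩
  2 ^ e * (17 * cube (300 + n))                ≡⟨ x*[17*y]≡17*[x*y] (2 ^ e) _ ⟩
  17 * (2 ^ e * cube (300 + n))                ≤⟨ *-monoʳ-≤ 17 bound ⟩
  17 * (growthConstant * fib (2 + n))          ≡⟨ x*[17*y]≡17*[x*y] growthConstant _ ⟨
  growthConstant * (17 * fib (2 + n))          ≤⟨ *-monoʳ-≤ growthConstant (17*fib≤fib+6 n) ⟩
  growthConstant * fib (8 + n)                 ∎
  where
  open ≤-Reasoning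
  e = 2 * (4 + n) / 3
  x*[17*y]≡17*[x*y] : ∀ x y → x * (17 * y) ≡ 17 * (x * y)
  x*[17*y]≡17*[x*y] = solve-∀

growthBound : ∀ n → GrowthBound n
growthBound (suc (suc (suc (suc (suc (suc n)))))) = growthBound-step n (growthBound n)
growthBound 0 = growthBound-base 0 tt
growthBound 1 = growthBound-base 1 tt
growthBound 2 = growthBound-base 2 tt
growthBound 3 = growthBound-base 3 tt
growthBound 4 = growthBound-base 4 tt
growthBound 5 = growthBound-base 5 tt

-- GrowthBound has one factor x = 300 + n more than needed; it absorbs (k + 1)·(2g + 1)².
bad-bound<fib : ∀ k n → 4 * suc k * growthConstant < 300 + n → suc k * #codes (4 + n) < fib (2 + n)
bad-bound<fib k n 4kC<x = *-cancelʳ-< x _ _ (begin-strict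
  suc k * (b * (b * P)) * x
    ≤⟨ *-monoˡ-≤ x (*-monoʳ-≤ (suc k) (*-mono-≤ b≤2x (*-monoˡ-≤ P b≤2x))) ⟩
  suc k * (2 * x * (2 * x * P)) * x          ≡⟨ regroup (suc k) x P ⟩
  4 * suc k * (P * (x * x * x))              ≡⟨ cong (λ c → 4 * suc k * (P * c)) (cube-def x) ⟨
  4 * suc k * (P * cube x)                   ≤⟨ *-monoʳ-≤ (4 * suc k) (growthBound n) ⟩
  4 * suc k * (growthConstant * fib (2 + n)) ≡⟨ *-assoc (4 * suc k) growthConstant _ ⟨
  4 * suc k * growthConstant * fib (2 + n)   <⟨ *-monoˡ-< (fib (2 + n)) {{>-nonZero (fib-pos (suc n))}} 4kC<x ⟩
  x * fib (2 + n)                            ≡⟨ *-comm x (fib (2 + n)) ⟩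
  fib (2 + n) * x                            ∎)
  where
  open ≤-Reasoning
  x = 300 + n
  b = suc (2 * (4 + n))
  P = 2 ^ (2 * (4 + n) / 3)
  b≤2x : b ≤ 2 * x
  b≤2x = ≤-trans (m≤m+n b 591) (≤-reflexive (slack n))
    where
    slack : ∀ n → suc (2 * (4 + n)) + 591 ≡ 2 * (300 + n)
    slack = solve-∀
  regroup : ∀ k x P → k * (2 * x * (2 * x * P)) * x ≡ 4 * k * (P * (x * x * x))
  regroup = solve-∀

bad-negligible : ∀ k → ∃[ G ] ∀ g → G ≤ g → suc k * #codes g < fib (g ∸ 2)
bad-negligible k = 4 + M , beyond
  where
  M = 4 * suc k * growthConstant
  beyond : ∀ g → 4 + M ≤ g → suc k * #codes g < fib (g ∸ 2)
  beyond g G≤g with m≤n⇒∃[o]m+o≡n G≤g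
  ... | o , refl = bad-bound<fib k (M + o) (s≤s (≤-trans (m≤m+n M o) (m≤n+m (M + o) 299)))

theorem1 : ∀ (k : ℕ) → ∃[ G ] ∀ (g : ℕ) → G ≤ g →
    ∃[ ns ] ∃[ as ]
      Enumerates (NSGenus g) ns
      × Enumerates (λ gs → NSGenus g gs × gcdLeft gs ≡ 1) as
      × suc k * (length ns ∸ length as) < length ns
theorem1 k with bad-negligible k
... | G , negligible = G , λ g G≤g → ns g , as g , ns-enum g , as-enum g , (begin-strict
  suc k * (length (ns g) ∸ length (as g)) ≡⟨ cong (suc k *_) (#ns∸#as≡#bs g) ⟩
  suc k * length (bs g)                   ≤⟨ *-monoʳ-≤ (suc k) (#bad-≤ g (bs-enum g)) ⟩
  suc k * #codes g                        <⟨ negligible g G≤g ⟩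
  fib (g ∸ 2)                             ≤⟨ fib-≤-#good g (as-enum g) ⟩
  length (as g)                           ≤⟨ length-filter good? (ns g) ⟩
  length (ns g)                           ∎)
  where
  open ≤-Reasoning
  good? : ∀ gs → Dec (gcdLeft gs ≡ 1)
  good? gs = gcdLeft gs ≟ 1
  ns = semigroupsOfGenus
  as = λ g → filter good? (ns g)
  bs = λ g → filter (∁? good?) (ns g)
  ns-enum = semigroupsOfGenus-enumerates
  as-enum = λ g → filter-enumerates good? (ns-enum g)
  bs-enum = λ g → filter-enumerates (∁? good?) (ns-enum g)
  #ns∸#as≡#bs : ∀ g → length (ns g) ∸ length (as g) ≡ length (bs g)
  #ns∸#as≡#bs g = trans (cong (_∸ length (as g)) (sym (length-filter-∁ good? (ns g))))
                        (m+n∸m≡n (length (as g)) (length (bs g)))
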